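{- For all connected graphs $G$ and $H$, each with at least one edge, $$\eta(G\,\square\,H\,\square\,P_2)\ \ge\ \omega(G)+\omega(H)+\min\{|V(G)|-\omega(G),|V(H)|-\omega(H)\}\ \ge\ \min\{|V(G)|,|V(H)|\}+\min\{\omega(G),\omega(H)\}\ \ge\ \min\{|V(G)|,|V(H)|\}+2.$$
   Context: All graphs are finite, simple and undirected. $\omega$ denotes clique number, $P_2$ is the path on two vertices, and $\eta(G)$ is the maximum $k$ such that $K_k$ is a minor of $G$. The Cartesian product $G\,\square\,H$ has vertex set $V(G)\times V(H)$, with $(v,x)(w,y)$ an edge iff ($vw\in E(G)$ and $x=y$) or ($v=w$ and $xy\in E(H)$). -}

module Defs where

open import Data.Nat using (ℕ; zero; suc; _*_; _≤_)
open import Data.Bool using (Bool; true; false; _∧_; _∨_; not; T)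
open import Data.Bool.Properties using (∧-comm; ∨-comm)
open import Data.Fin using (Fin; zero; suc; remQuot)
open import Data.Fin.Properties using (_≟_)
open import Data.Maybe using (Maybe; just)
open import Data.Product using (Σ; ∃; _×_; _,_; proj₁; proj₂)
open import Data.Unit using (⊤)
open import Relation.Nullary using (¬_; yes; no)
open import Relation.Nullary.Decidable using (⌊_⌋)
open import Relation.Binary.PropositionalEquality using (_≡_; refl; sym; cong; cong₂)
open import Function.Definitions using (Injective)

record Graph : Set where
  field
    n      : ℕ
    adj    : Fin n → Fin n → Bool
    adj-sym    : ∀ u v → adj u v ≡ adj v u
    adj-irrefl : ∀ v → adj v v ≡ false
open Graph public

∣V∣ : Graph → ℕ
∣V∣ G = n G

Edge : (G : Graph) → Fin (n G) → Fin (n G) → Set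
Edge G u v = T (adj G u v)

HasEdge : Graph → Set
HasEdge G = Σ (Fin (n G)) λ u → Σ (Fin (n G)) λ v → Edge G u v

data WalkIn (G : Graph) (P : Fin (n G) → Set) : Fin (n G) → Fin (n G) → Set where
  here : ∀ {u} → P u → WalkIn G P u u
  step : ∀ {u w v} → P u → Edge G u w → WalkIn G P w v → WalkIn G P u v

Connected : Graph → Set
Connected G = ∀ u v → WalkIn G (λ _ → ⊤) u v

HasClique : Graph → ℕ → Set
HasClique G k = Σ (Fin k → Fin (n G)) λ f →
  Injective _≡_ _≡_ f × (∀ i j → ¬ (i ≡ j) → Edge G (f i) (f j))

IsCliqueNumber : Graph → ℕ → Set
IsCliqueNumber G w = HasClique G w × (∀ k → HasClique G k → k ≤ w)

-- Branch sets are encoded by a map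
-- β : V(G) → Maybe (Fin k)  (β v ≡ just i  iff  v lies in branch set i).
HasCliqueMinor : Graph → ℕ → Set
HasCliqueMinor G k = Σ (Fin (n G) → Maybe (Fin k)) λ β →
    (∀ i → Σ (Fin (n G)) λ v → β v ≡ just i)
  × (∀ i u v → β u ≡ just i → β v ≡ just i → WalkIn G (λ x → β x ≡ just i) u v)
  × (∀ i j → ¬ (i ≡ j) → Σ (Fin (n G)) λ u → Σ (Fin (n G)) λ v →
        β u ≡ just i × β v ≡ just j × Edge G u v)

IsHadwigerNumber : Graph → ℕ → Set
IsHadwigerNumber G h = HasCliqueMinor G h × (∀ k → HasCliqueMinor G k → k ≤ h)

_==_ : ∀ {m} → Fin m → Fin m → Bool
a == b = ⌊ a ≟ b ⌋

==-sym : ∀ {m} (a b : Fin m) → (a == b) ≡ (b == a)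
==-sym a b with a ≟ b | b ≟ a
... | yes _ | yes _ = refl
... | no _  | no _  = refl
... | yes p | no q  with q (sym p)
... | ()
==-sym a b | no q | yes p with q (sym p)
... | ()

==-refl : ∀ {m} (a : Fin m) → (a == a) ≡ true
==-refl a with a ≟ a
... | yes _ = refl
... | no q with q refl
... | ()

prodAdj : (G H : Graph) → (Fin (n G) × Fin (n H)) → (Fin (n G) × Fin (n H)) → Bool
prodAdj G H (v , x) (w , y) = (adj G v w ∧ (x == y)) ∨ ((v == w) ∧ adj H x y)

-- Cartesian product G □ H, with vertex (v , x) encoded as an element of
-- Fin (n G * n H) via the bijection remQuot.
_□_ : Graph → Graph → Graph
G □ H = record
  { n = n G * n H
  ; adj = λ a b → prodAdj G H (remQuot (n H) a) (remQuot (n H) b)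
  ; adj-sym = λ a b → symP (remQuot (n H) a) (remQuot (n H) b)
  ; adj-irrefl = λ a → irrP (remQuot (n H) a)
  }
  where
  symP : ∀ p q → prodAdj G H p q ≡ prodAdj G H q p
  symP (v , x) (w , y) = cong₂ _∨_ (cong₂ _∧_ (adj-sym G v w) (==-sym x y))
                                   (cong₂ _∧_ (==-sym v w) (adj-sym H x y))
  irrP : ∀ p → prodAdj G H p p ≡ false
  irrP (v , x) rewrite adj-irrefl G v | ==-refl v | adj-irrefl H x = refl

infixl 7 _□_

P₂ : Graph
P₂ = record
  { n = 2
  ; adj = λ a b → not (a == b)
  ; adj-sym = λ a b → cong not (==-sym a b)
  ; adj-irrefl = λ a → cong not (==-refl a)
  }

module Submission where

-- Let ωG, ωH be the clique numbers and m = min(|V(G)| ∸ ωG, |V(H)| ∸ ωH).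
-- Call the vertices (v , y , 0) the row layer and (v , y , 1) the column
-- layer of G □ H □ P₂.  For v ∈ V(G) the "row" of v is {(v , y , 0) | y ∈ H},
-- a copy of H; for y ∈ V(H) the "column" of y is {(v , y , 1) | v ∈ G}, a
-- copy of G.  Every row meets every column by a rung edge (v , y , 0)(v , y , 1).
-- A row-column system assigns to each branch index at most one row and at
-- most one column (injectively), so that any two indices touch: a row of one
-- and a column of the other, or adjacent rows, or adjacent columns.  For
-- connected G and H such a system with K indices yields a K_K minor.
-- The system used has ωG indices owning the rows of a maximum clique of G,
-- ωH indices owning the columns of a maximum clique of H, and m indices each
-- owning one further row and one further column; the m further vertices
-- exist because an injection into Fin N can be extended while room remains.
-- The two numerical inequalities are elementary arithmetic, using that an
-- edge is a 2-clique and that a clique injects into the vertex set.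

open import Data.Nat using (ℕ; zero; suc; _+_; _∸_; _≤_; _<_; _⊓_; _*_)
open import Data.Nat.Properties
  using (≤-trans; ≤-reflexive; ≤-total; +-mono-≤; +-monoʳ-≤; +-suc; +-assoc; +-comm;
         m+[n∸m]≡n; m⊓n≤m; m⊓n≤n; m≤n⇒m⊓n≡m; m≥n⇒m⊓n≡n; ⊓-glb; <⇒≱; n≤1+n)
open import Data.Bool using (T)
open import Data.Bool.Properties using (T-∨; T-∧; T-≡)
open import Data.Fin using (Fin; zero; suc; remQuot; combine; splitAt; join)
open import Data.Fin.Properties
  using (remQuot-combine; combine-surjective; join-splitAt; splitAt-join; injective⇒≤; any?; all?)
  renaming (_≟_ to _≟ᶠ_)
open import Data.Maybe using (Maybe; just; nothing)
import Data.Maybe as Maybe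
open import Data.Maybe.Properties using (just-injective)
import Data.Maybe.Properties as MaybeP
open import Data.Product using (Σ; ∃; _×_; _,_; proj₁; proj₂)
open import Data.Sum using (_⊎_; inj₁; inj₂; [_,_]′)
import Data.Sum as Sum
open import Data.Sum.Properties using (inj₁-injective; inj₂-injective)
open import Data.Unit using (⊤; tt)
open import Data.Empty using (⊥-elim)
open import Function using (_∘_; Equivalence)
open import Function.Definitions using (Injective)
open import Relation.Nullary using (yes; no; Dec; ¬?)
open import Relation.Binary.PropositionalEquality
  using (_≡_; _≢_; refl; sym; trans; cong; subst; subst₂; module ≡-Reasoning)

open import Defs

□-edge : ∀ G H {v v' : Fin (n G)} {y y' : Fin (n H)} →
  T (prodAdj G H (v , y) (v' , y')) → Edge (G □ H) (combine v y) (combine v' y')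
□-edge G H {v} {v'} {y} {y'} =
  subst₂ (λ p q → T (prodAdj G H p q))
    (sym (remQuot-combine {n G} {n H} v y)) (sym (remQuot-combine {n G} {n H} v' y'))

□-edgeˡ : ∀ G H {v v' : Fin (n G)} (y : Fin (n H)) →
  Edge G v v' → Edge (G □ H) (combine v y) (combine v' y)
□-edgeˡ G H y e =
  □-edge G H (Equivalence.from T-∨ (inj₁ (Equivalence.from T-∧ (e , Equivalence.from T-≡ (==-refl y)))))

□-edgeʳ : ∀ G H (v : Fin (n G)) {y y' : Fin (n H)} →
  Edge H y y' → Edge (G □ H) (combine v y) (combine v y')
□-edgeʳ G H v e =
  □-edge G H (Equivalence.from T-∨ (inj₂ (Equivalence.from T-∧ (Equivalence.from T-≡ (==-refl v) , e))))

_++ʷ_ : ∀ {G P u w z} → WalkIn G P u w → WalkIn G P w z → WalkIn G P u z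
here _       ++ʷ q = q
step p e w   ++ʷ q = step p e (w ++ʷ q)

homWalk : ∀ {A B : Graph} {Q : Fin (n B) → Set} (φ : Fin (n A) → Fin (n B)) →
  (∀ {x x'} → Edge A x x' → Edge B (φ x) (φ x')) → (∀ x → Q (φ x)) →
  ∀ {x x'} → WalkIn A (λ _ → ⊤) x x' → WalkIn B Q (φ x) (φ x')
homWalk φ hom inQ (here _)     = here (inQ _)
homWalk φ hom inQ (step _ e w) = step (inQ _) (hom e) (homWalk φ hom inQ w)

PartialInjective : ∀ {I A : Set} → (I → Maybe A) → Set
PartialInjective f = ∀ {i j v} → f i ≡ just v → f j ≡ just v → i ≡ j

map-partialInjective : ∀ {I A B : Set} {g : A → B} {f : I → Maybe A} →
  Injective _≡_ _≡_ g → PartialInjective f → PartialInjective (Maybe.map g ∘ f)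
map-partialInjective {f = f} g-inj f-inj {i} {j} fi fj
  with f i in eqi | f j in eqj
... | just x | just y =
  f-inj eqi (trans eqj (cong just (g-inj (just-injective (trans fj (sym fi))))))

record PartialInverse {K A : ℕ} (f : Fin K → Maybe (Fin A)) : Set where
  field
    inv      : Fin A → Maybe (Fin K)
    sound    : ∀ {i v} → inv v ≡ just i → f i ≡ just v
    complete : ∀ {i v} → f i ≡ just v → inv v ≡ just i

partialInverse : ∀ {K A} (f : Fin K → Maybe (Fin A)) → PartialInjective f → PartialInverse f
partialInverse {K} f f-inj = record
  { inv = λ v → fromSearch (search v)
  ; sound = λ {_} {v} → sound (search v)
  ; complete = λ {_} {v} → complete (search v)
  }
  where
  search : ∀ v → Dec (∃ λ i → f i ≡ just v)
  search v = any? (λ i → MaybeP.≡-dec _≟ᶠ_ (f i) (just v))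

  fromSearch : ∀ {v} → Dec (∃ λ i → f i ≡ just v) → Maybe (Fin K)
  fromSearch (yes (i , _)) = just i
  fromSearch (no _)        = nothing

  sound : ∀ {i v} (d : Dec (∃ λ i → f i ≡ just v)) → fromSearch d ≡ just i → f i ≡ just v
  sound (yes (_ , fi)) refl = fi

  complete : ∀ {i v} (d : Dec (∃ λ i → f i ≡ just v)) → f i ≡ just v → fromSearch d ≡ just i
  complete (yes (_ , fj)) fi = cong just (f-inj fj fi)
  complete {i} (no none)  fi = ⊥-elim (none (i , fi))

splitAt-injective : ∀ a {m} → Injective _≡_ _≡_ (splitAt a {m})
splitAt-injective a {m} {x} {y} e =
  trans (sym (join-splitAt a m x)) (trans (cong (join a m) e) (join-splitAt a m y))

map₁-injective : ∀ {A B C : Set} {f : A → B} → Injective _≡_ _≡_ f →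
  Injective _≡_ _≡_ (Sum.map₁ {B = C} f)
map₁-injective f-inj {inj₁ _} {inj₁ _} e = cong inj₁ (f-inj (inj₁-injective e))
map₁-injective f-inj {inj₂ _} {inj₂ _} e = cong inj₂ (inj₂-injective e)

[,]-injective : ∀ {A B C : Set} {f : A → C} {g : B → C} →
  Injective _≡_ _≡_ f → Injective _≡_ _≡_ g → (∀ a b → f a ≢ g b) →
  Injective _≡_ _≡_ [ f , g ]′
[,]-injective f-inj g-inj disj {inj₁ a} {inj₁ a'} e = cong inj₁ (f-inj e)
[,]-injective f-inj g-inj disj {inj₁ a} {inj₂ b}  e = ⊥-elim (disj a b e)
[,]-injective f-inj g-inj disj {inj₂ b} {inj₁ a}  e = ⊥-elim (disj a b (sym e))
[,]-injective f-inj g-inj disj {inj₂ b} {inj₂ b'} e = cong inj₂ (g-inj e)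

-- An injection Fin k → Fin N with k < N misses some value: otherwise taking
-- preimages would give an injection Fin N → Fin k.
missedValue : ∀ {k N} (h : Fin k → Fin N) → Injective _≡_ _≡_ h → k < N →
  ∃ λ v → ∀ i → h i ≢ v
missedValue {k} {N} h h-inj k<N
  with any? (λ v → all? (λ i → ¬? (h i ≟ᶠ v)))
... | yes missed = missed
... | no nothingMissed = ⊥-elim (<⇒≱ k<N (injective⇒≤ {f = preimage} preimage-injective))
  where
  hit : ∀ v → ∃ λ i → h i ≡ v
  hit v with any? (λ i → h i ≟ᶠ v)
  ... | yes found = found
  ... | no none   = ⊥-elim (nothingMissed (v , λ i e → none (i , e)))

  preimage : Fin N → Fin k
  preimage v = proj₁ (hit v)

  preimage-injective : Injective _≡_ _≡_ preimage
  preimage-injective {v} {w} e =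
    trans (sym (proj₂ (hit v))) (trans (cong h e) (proj₂ (hit w)))

record Complement {a N} (c : Fin a → Fin N) (m : ℕ) : Set where
  field
    extra           : Fin m → Fin N
    extra-injective : Injective _≡_ _≡_ extra
    disjoint        : ∀ p q → c p ≢ extra q

  joined-injective : Injective _≡_ _≡_ c → Injective _≡_ _≡_ [ c , extra ]′
  joined-injective c-inj = [,]-injective c-inj extra-injective disjoint

complement : ∀ {a N} (c : Fin a → Fin N) → Injective _≡_ _≡_ c →
  ∀ m → a + m ≤ N → Complement c m
complement c c-inj zero _ = record
  { extra = λ () ; extra-injective = λ { {()} } ; disjoint = λ _ () }
complement {a} {N} c c-inj (suc m) a+1+m≤N = record
  { extra = extra′ ; extra-injective = extra′-injective ; disjoint = disjoint′ }
  where
  open Complement (complement c c-inj m (≤-trans (+-monoʳ-≤ a (n≤1+n m)) a+1+m≤N))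

  current : Fin (a + m) → Fin N
  current = [ c , extra ]′ ∘ splitAt a

  fresh : ∃ λ v → ∀ x → current x ≢ v
  fresh = missedValue current
    (λ e → splitAt-injective a (joined-injective c-inj e))
    (≤-trans (≤-reflexive (sym (+-suc a m))) a+1+m≤N)

  v : Fin N
  v = proj₁ fresh

  notCurrent : ∀ x → [ c , extra ]′ x ≢ v
  notCurrent x e = proj₂ fresh (join a m x) (trans (cong [ c , extra ]′ (splitAt-join a m x)) e)

  extra′ : Fin (suc m) → Fin N
  extra′ zero    = v
  extra′ (suc q) = extra q

  extra′-injective : Injective _≡_ _≡_ extra′
  extra′-injective {zero}  {zero}  _ = refl
  extra′-injective {zero}  {suc q} e = ⊥-elim (notCurrent (inj₂ q) (sym e))
  extra′-injective {suc q} {zero}  e = ⊥-elim (notCurrent (inj₂ q) e)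
  extra′-injective {suc q} {suc r} e = cong suc (extra-injective e)

  disjoint′ : ∀ p q → c p ≢ extra′ q
  disjoint′ p zero    = notCurrent (inj₁ p)
  disjoint′ p (suc q) = disjoint p q

pattern rowLayer = zero
pattern colLayer = suc zero

module _ (G H : Graph) {I : Set}
         (row : I → Maybe (Fin (n G))) (col : I → Maybe (Fin (n H))) where

  data Occupied (i : I) : Set where
    has-row : ∀ {v} → row i ≡ just v → Occupied i
    has-col : ∀ {y} → col i ≡ just y → Occupied i

  data Touches (i j : I) : Set where
    row-col : ∀ {v y} → row i ≡ just v → col j ≡ just y → Touches i j
    col-row : ∀ {v y} → col i ≡ just y → row j ≡ just v → Touches i j
    row-row : ∀ {v v'} → row i ≡ just v → row j ≡ just v' → Edge G v v' → Touches i j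
    col-col : ∀ {y y'} → col i ≡ just y → col j ≡ just y' → Edge H y y' → Touches i j

record RowColumnSystem (G H : Graph) (I : Set) : Set where
  field
    row           : I → Maybe (Fin (n G))
    col           : I → Maybe (Fin (n H))
    row-injective : PartialInjective row
    col-injective : PartialInjective col
    occupied      : ∀ i → Occupied G H row col i
    touching      : ∀ {i j} → i ≢ j → Touches G H row col i j

reindex : ∀ {G H I J} → RowColumnSystem G H I → (e : J → I) → Injective _≡_ _≡_ e →
  RowColumnSystem G H J
reindex {G} {H} S e e-inj = record
  { row = row ∘ e
  ; col = col ∘ e
  ; row-injective = λ ri rj → e-inj (row-injective ri rj)
  ; col-injective = λ ci cj → e-inj (col-injective ci cj)
  ; occupied = λ i → occupiedᵉ (occupied (e i))
  ; touching = λ i≢j → touchingᵉ (touching (λ ei≡ej → i≢j (e-inj ei≡ej)))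
  }
  where
  open RowColumnSystem S

  occupiedᵉ : ∀ {i} → Occupied G H row col (e i) → Occupied G H (row ∘ e) (col ∘ e) i
  occupiedᵉ (has-row r) = has-row r
  occupiedᵉ (has-col c) = has-col c

  touchingᵉ : ∀ {i j} → Touches G H row col (e i) (e j) → Touches G H (row ∘ e) (col ∘ e) i j
  touchingᵉ (row-col r c)   = row-col r c
  touchingᵉ (col-row c r)   = col-row c r
  touchingᵉ (row-row r r' a) = row-row r r' a
  touchingᵉ (col-col c c' a) = col-col c c' a

-- A row-column system on Fin K gives a K_K minor of G □ H □ P₂ for connected
-- G and H; branch set i is the row and the column owned by i.  The vertices
-- v₀, y₀ are used to exhibit vertices of rows and columns.
module RowColumnMinor (G H : Graph) (G-conn : Connected G) (H-conn : Connected H)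
                      (v₀ : Fin (n G)) (y₀ : Fin (n H))
                      {K : ℕ} (S : RowColumnSystem G H (Fin K)) where

  open RowColumnSystem S

  P : Graph
  P = G □ H □ P₂

  ⟪_,_,_⟫ : Fin (n G) → Fin (n H) → Fin 2 → Fin (n P)
  ⟪ v , y , l ⟫ = combine (combine v y) l

  data Coords : Fin (n P) → Set where
    at : ∀ v y l → Coords ⟪ v , y , l ⟫

  coords : ∀ w → Coords w
  coords w with combine-surjective {n G * n H} {2} w
  ... | c , l , refl with combine-surjective {n G} {n H} c
  ...   | v , y , refl = at v y l

  rowEdge : ∀ v {y y'} l → Edge H y y' → Edge P ⟪ v , y , l ⟫ ⟪ v , y' , l ⟫
  rowEdge v l e = □-edgeˡ (G □ H) P₂ l (□-edgeʳ G H v e)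

  colEdge : ∀ {v v'} y l → Edge G v v' → Edge P ⟪ v , y , l ⟫ ⟪ v' , y , l ⟫
  colEdge y l e = □-edgeˡ (G □ H) P₂ l (□-edgeˡ G H y e)

  rungUp : ∀ v y → Edge P ⟪ v , y , rowLayer ⟫ ⟪ v , y , colLayer ⟫
  rungUp v y = □-edgeʳ (G □ H) P₂ (combine v y) tt

  rungDown : ∀ v y → Edge P ⟪ v , y , colLayer ⟫ ⟪ v , y , rowLayer ⟫
  rungDown v y = □-edgeʳ (G □ H) P₂ (combine v y) tt

  rowOf : PartialInverse row
  rowOf = partialInverse row row-injective
  colOf : PartialInverse col
  colOf = partialInverse col col-injective
  open PartialInverse rowOf using () renaming (inv to rowIndex; sound to rowSound; complete to rowComplete)
  open PartialInverse colOf using () renaming (inv to colIndex; sound to colSound; complete to colComplete)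

  rowIndex-unique : ∀ {i v v'} → rowIndex v ≡ just i → rowIndex v' ≡ just i → v ≡ v'
  rowIndex-unique r r' = just-injective (trans (sym (rowSound r)) (rowSound r'))

  colIndex-unique : ∀ {i y y'} → colIndex y ≡ just i → colIndex y' ≡ just i → y ≡ y'
  colIndex-unique c c' = just-injective (trans (sym (colSound c)) (colSound c'))

  label : Fin (n G) × Fin (n H) → Fin 2 → Maybe (Fin K)
  label (v , y) rowLayer = rowIndex v
  label (v , y) colLayer = colIndex y

  branch : Fin (n P) → Maybe (Fin K)
  branch w = label (remQuot (n H) (proj₁ (remQuot {n G * n H} 2 w))) (proj₂ (remQuot {n G * n H} 2 w))

  branch-⟪⟫ : ∀ v y l → branch ⟪ v , y , l ⟫ ≡ label (v , y) l
  branch-⟪⟫ v y l = begin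
    branch ⟪ v , y , l ⟫
      ≡⟨ cong (λ q → label (remQuot (n H) (proj₁ q)) (proj₂ q)) (remQuot-combine {n G * n H} {2} (combine v y) l) ⟩
    label (remQuot (n H) (combine v y)) l
      ≡⟨ cong (λ p → label p l) (remQuot-combine {n G} {n H} v y) ⟩
    label (v , y) l ∎
    where open ≡-Reasoning

  InBranch : Fin K → Fin (n P) → Set
  InBranch i w = branch w ≡ just i

  inBranch : ∀ {i} v y l → label (v , y) l ≡ just i → InBranch i ⟪ v , y , l ⟫
  inBranch v y l b = trans (branch-⟪⟫ v y l) b

  -- Rows are copies of H and columns are copies of G, hence connected.
  rowWalk : ∀ {i v} → rowIndex v ≡ just i → ∀ y y' →
    WalkIn P (InBranch i) ⟪ v , y , rowLayer ⟫ ⟪ v , y' , rowLayer ⟫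
  rowWalk {v = v} r y y' =
    homWalk (λ z → ⟪ v , z , rowLayer ⟫) (rowEdge v rowLayer) (λ z → inBranch v z rowLayer r) (H-conn y y')

  colWalk : ∀ {i y} → colIndex y ≡ just i → ∀ v v' →
    WalkIn P (InBranch i) ⟪ v , y , colLayer ⟫ ⟪ v' , y , colLayer ⟫
  colWalk {y = y} c v v' =
    homWalk (λ z → ⟪ z , y , colLayer ⟫) (colEdge y colLayer) (λ z → inBranch z y colLayer c) (G-conn v v')

  -- Within a branch set, the row and the column are joined by a rung.
  branchWalk : ∀ {i} v y l v' y' l' → label (v , y) l ≡ just i → label (v' , y') l' ≡ just i →
    WalkIn P (InBranch i) ⟪ v , y , l ⟫ ⟪ v' , y' , l' ⟫
  branchWalk v y rowLayer v' y' rowLayer r r' with rowIndex-unique r r'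
  ... | refl = rowWalk r y y'
  branchWalk v y colLayer v' y' colLayer c c' with colIndex-unique c c'
  ... | refl = colWalk c v v'
  branchWalk v y rowLayer v' y' colLayer r c =
    rowWalk r y y' ++ʷ step (inBranch v y' rowLayer r) (rungUp v y') (colWalk c v v')
  branchWalk v y colLayer v' y' rowLayer c r =
    colWalk c v v' ++ʷ step (inBranch v' y colLayer c) (rungDown v' y) (rowWalk r y y')

  branch-connected : ∀ i u w → InBranch i u → InBranch i w → WalkIn P (InBranch i) u w
  branch-connected i u w bu bw with coords u | coords w
  ... | at v y l | at v' y' l' =
    branchWalk v y l v' y' l' (trans (sym (branch-⟪⟫ v y l)) bu) (trans (sym (branch-⟪⟫ v' y' l')) bw)

  branch-nonempty : ∀ i → Σ (Fin (n P)) (InBranch i)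
  branch-nonempty i with occupied i
  ... | has-row {v} r = ⟪ v , y₀ , rowLayer ⟫ , inBranch v y₀ rowLayer (rowComplete r)
  ... | has-col {y} c = ⟪ v₀ , y , colLayer ⟫ , inBranch v₀ y colLayer (colComplete c)

  BranchEdge : Fin K → Fin K → Set
  BranchEdge i j = Σ (Fin (n P)) λ u → Σ (Fin (n P)) λ w → InBranch i u × InBranch j w × Edge P u w

  branch-edge : ∀ i j → Touches G H row col i j → BranchEdge i j
  branch-edge i j (row-col {v} {y} r c) =
    ⟪ v , y , rowLayer ⟫ , ⟪ v , y , colLayer ⟫ ,
    inBranch v y rowLayer (rowComplete r) , inBranch v y colLayer (colComplete c) , rungUp v y
  branch-edge i j (col-row {v} {y} c r) =
    ⟪ v , y , colLayer ⟫ , ⟪ v , y , rowLayer ⟫ ,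
    inBranch v y colLayer (colComplete c) , inBranch v y rowLayer (rowComplete r) , rungDown v y
  branch-edge i j (row-row {v} {v'} r r' e) =
    ⟪ v , y₀ , rowLayer ⟫ , ⟪ v' , y₀ , rowLayer ⟫ ,
    inBranch v y₀ rowLayer (rowComplete r) , inBranch v' y₀ rowLayer (rowComplete r') ,
    colEdge y₀ rowLayer e
  branch-edge i j (col-col {y} {y'} c c' e) =
    ⟪ v₀ , y , colLayer ⟫ , ⟪ v₀ , y' , colLayer ⟫ ,
    inBranch v₀ y colLayer (colComplete c) , inBranch v₀ y' colLayer (colComplete c') ,
    rowEdge v₀ colLayer e

  minor : HasCliqueMinor P K
  minor = branch , branch-nonempty , branch-connected , λ i j i≢j → branch-edge i j (touching i≢j)

BranchIndex : ℕ → ℕ → ℕ → Set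
BranchIndex a b m = (Fin a ⊎ Fin b) ⊎ Fin m

pattern cliqueG p = inj₁ (inj₁ p)
pattern cliqueH q = inj₁ (inj₂ q)
pattern both r    = inj₂ r

toBranchIndex : ∀ a b m → Fin (a + b + m) → BranchIndex a b m
toBranchIndex a b m = Sum.map₁ (splitAt a) ∘ splitAt (a + b)

toBranchIndex-injective : ∀ a b m → Injective _≡_ _≡_ (toBranchIndex a b m)
toBranchIndex-injective a b m e =
  splitAt-injective (a + b) (map₁-injective (splitAt-injective a) e)

rowSlot : ∀ {a b m} → BranchIndex a b m → Maybe (Fin a ⊎ Fin m)
rowSlot (cliqueG p) = just (inj₁ p)
rowSlot (cliqueH q) = nothing
rowSlot (both r)   = just (inj₂ r)

colSlot : ∀ {a b m} → BranchIndex a b m → Maybe (Fin b ⊎ Fin m)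
colSlot (cliqueG p) = nothing
colSlot (cliqueH q) = just (inj₁ q)
colSlot (both r)   = just (inj₂ r)

rowSlot-injective : ∀ {a b m} → PartialInjective (rowSlot {a} {b} {m})
rowSlot-injective {i = cliqueG _} {cliqueG _} refl refl = refl
rowSlot-injective {i = cliqueG _} {both _}    refl ()
rowSlot-injective {i = both _}    {cliqueG _} refl ()
rowSlot-injective {i = both _}    {both _}    refl refl = refl
rowSlot-injective {i = cliqueH _} ()
rowSlot-injective {i = cliqueG _} {cliqueH _} _ ()
rowSlot-injective {i = both _}    {cliqueH _} _ ()

colSlot-injective : ∀ {a b m} → PartialInjective (colSlot {a} {b} {m})
colSlot-injective {i = cliqueH _} {cliqueH _} refl refl = refl
colSlot-injective {i = cliqueH _} {both _}    refl ()
colSlot-injective {i = both _}    {cliqueH _} refl ()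
colSlot-injective {i = both _}    {both _}    refl refl = refl
colSlot-injective {i = cliqueG _} ()
colSlot-injective {i = cliqueH _} {cliqueG _} _ ()
colSlot-injective {i = both _}    {cliqueG _} _ ()

record Clique (G : Graph) (a : ℕ) : Set where
  field
    vertex    : Fin a → Fin (n G)
    injective : Injective _≡_ _≡_ vertex
    adjacent  : ∀ p p' → p ≢ p' → Edge G (vertex p) (vertex p')

toClique : ∀ {G a} → HasClique G a → Clique G a
toClique (f , f-inj , f-adj) = record { vertex = f ; injective = f-inj ; adjacent = f-adj }

cliqueSystem : ∀ {G H a b m} (A : Clique G a) (B : Clique H b) →
  Complement (Clique.vertex A) m → Complement (Clique.vertex B) m →
  RowColumnSystem G H (BranchIndex a b m)
cliqueSystem {G} {H} {a} {b} {m} A B XG XH = record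
  { row = row
  ; col = col
  ; row-injective = map-partialInjective (XG.joined-injective A.injective) rowSlot-injective
  ; col-injective = map-partialInjective (XH.joined-injective B.injective) colSlot-injective
  ; occupied = occupied
  ; touching = touching
  }
  where
  module A = Clique A
  module B = Clique B
  module XG = Complement XG
  module XH = Complement XH

  row : BranchIndex a b m → Maybe (Fin (n G))
  row = Maybe.map [ A.vertex , XG.extra ]′ ∘ rowSlot

  col : BranchIndex a b m → Maybe (Fin (n H))
  col = Maybe.map [ B.vertex , XH.extra ]′ ∘ colSlot

  occupied : ∀ i → Occupied G H row col i
  occupied (cliqueG p) = has-row refl
  occupied (cliqueH q) = has-col refl
  occupied (both r)   = has-row refl

  -- Clique indices of the same graph touch by a clique edge; all other
  -- pairs by a row meeting a column.
  touching : ∀ {i j} → i ≢ j → Touches G H row col i j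
  touching {cliqueG p} {cliqueG p'} i≢j = row-row refl refl (A.adjacent p p' (i≢j ∘ cong cliqueG))
  touching {cliqueH q} {cliqueH q'} i≢j = col-col refl refl (B.adjacent q q' (i≢j ∘ cong cliqueH))
  touching {cliqueG _} {cliqueH _} _ = row-col refl refl
  touching {cliqueG _} {both _}    _ = row-col refl refl
  touching {cliqueH _} {cliqueG _} _ = col-row refl refl
  touching {cliqueH _} {both _}    _ = col-row refl refl
  touching {both _}    {cliqueG _} _ = col-row refl refl
  touching {both _}    {cliqueH _} _ = row-col refl refl
  touching {both _}    {both _}    _ = row-col refl refl

edgeClique : ∀ G → HasEdge G → HasClique G 2
edgeClique G (u , v , e) = vertex , vertex-injective , vertex-adjacent
  where
  u≢v : u ≢ v
  u≢v refl = subst T (adj-irrefl G u) e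

  vertex : Fin 2 → Fin (n G)
  vertex zero = u
  vertex (suc zero) = v

  vertex-injective : Injective _≡_ _≡_ vertex
  vertex-injective {zero}     {zero}     _ = refl
  vertex-injective {zero}     {suc zero} x = ⊥-elim (u≢v x)
  vertex-injective {suc zero} {zero}     x = ⊥-elim (u≢v (sym x))
  vertex-injective {suc zero} {suc zero} _ = refl

  vertex-adjacent : ∀ i j → i ≢ j → Edge G (vertex i) (vertex j)
  vertex-adjacent zero       zero       i≢j = ⊥-elim (i≢j refl)
  vertex-adjacent zero       (suc zero) _   = e
  vertex-adjacent (suc zero) zero       _   = subst T (adj-sym G u v) e
  vertex-adjacent (suc zero) (suc zero) i≢j = ⊥-elim (i≢j refl)

cliqueNumber≤∣V∣ : ∀ {G w} → IsCliqueNumber G w → w ≤ ∣V∣ G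
cliqueNumber≤∣V∣ ((f , f-inj , _) , _) = injective⇒≤ {f = f} f-inj

-- a + b + min(N ∸ a, M ∸ b) is min(N + b, M + a) when a ≤ N, b ≤ M.
min-bound : ∀ N M a b → a ≤ N → b ≤ M →
  (N ⊓ M) + (a ⊓ b) ≤ a + b + ((N ∸ a) ⊓ (M ∸ b))
min-bound N M a b a≤N b≤M with ≤-total (N ∸ a) (M ∸ b)
... | inj₁ le = ≤-trans (+-mono-≤ (m⊓n≤m N M) (m⊓n≤n a b)) (≤-reflexive (sym (begin
      a + b + ((N ∸ a) ⊓ (M ∸ b)) ≡⟨ cong (a + b +_) (m≤n⇒m⊓n≡m le) ⟩
      a + b + (N ∸ a)             ≡⟨ +-assoc a b (N ∸ a) ⟩
      a + (b + (N ∸ a))           ≡⟨ cong (a +_) (+-comm b (N ∸ a)) ⟩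
      a + ((N ∸ a) + b)           ≡⟨ sym (+-assoc a (N ∸ a) b) ⟩
      a + (N ∸ a) + b             ≡⟨ cong (_+ b) (m+[n∸m]≡n a≤N) ⟩
      N + b                       ∎)))
  where open ≡-Reasoning
... | inj₂ le = ≤-trans (+-mono-≤ (m⊓n≤n N M) (m⊓n≤m a b)) (≤-reflexive (sym (begin
      a + b + ((N ∸ a) ⊓ (M ∸ b)) ≡⟨ cong (a + b +_) (m≥n⇒m⊓n≡n le) ⟩
      a + b + (M ∸ b)             ≡⟨ +-assoc a b (M ∸ b) ⟩
      a + (b + (M ∸ b))           ≡⟨ cong (a +_) (m+[n∸m]≡n b≤M) ⟩
      a + M                       ≡⟨ +-comm a M ⟩
      M + a                       ∎)))
  where open ≡-Reasoning

room-left : ∀ N M a → a ≤ N → a + ((N ∸ a) ⊓ M) ≤ N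
room-left N M a a≤N = ≤-trans (+-monoʳ-≤ a (m⊓n≤m (N ∸ a) M)) (≤-reflexive (m+[n∸m]≡n a≤N))

room-right : ∀ N M b → b ≤ M → b + (N ⊓ (M ∸ b)) ≤ M
room-right N M b b≤M = ≤-trans (+-monoʳ-≤ b (m⊓n≤n N (M ∸ b))) (≤-reflexive (m+[n∸m]≡n b≤M))

mainTheorem13 : (G H : Graph) → Connected G → Connected H → HasEdge G → HasEdge H →
    (ωG ωH : ℕ) → IsCliqueNumber G ωG → IsCliqueNumber H ωH →
      HasCliqueMinor (G □ H □ P₂) (ωG + ωH + ((∣V∣ G ∸ ωG) ⊓ (∣V∣ H ∸ ωH)))
    × ((∣V∣ G ⊓ ∣V∣ H) + (ωG ⊓ ωH) ≤ ωG + ωH + ((∣V∣ G ∸ ωG) ⊓ (∣V∣ H ∸ ωH)))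
    × ((∣V∣ G ⊓ ∣V∣ H) + 2 ≤ (∣V∣ G ⊓ ∣V∣ H) + (ωG ⊓ ωH))
mainTheorem13 G H G-conn H-conn G-edge H-edge ωG ωH ωG-def@(ωG-clique , ωG-max) ωH-def@(ωH-clique , ωH-max) =
  RowColumnMinor.minor G H G-conn H-conn (proj₁ G-edge) (proj₁ H-edge) system ,
  min-bound (n G) (n H) ωG ωH ωG≤∣V∣ ωH≤∣V∣ ,
  +-monoʳ-≤ (n G ⊓ n H) (⊓-glb (ωG-max 2 (edgeClique G G-edge)) (ωH-max 2 (edgeClique H H-edge)))
  where
  m : ℕ
  m = (n G ∸ ωG) ⊓ (n H ∸ ωH)
  ωG≤∣V∣ : ωG ≤ n G
  ωG≤∣V∣ = cliqueNumber≤∣V∣ {G} ωG-def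
  ωH≤∣V∣ : ωH ≤ n H
  ωH≤∣V∣ = cliqueNumber≤∣V∣ {H} ωH-def
  A : Clique G ωG
  A = toClique ωG-clique
  B : Clique H ωH
  B = toClique ωH-clique
  system : RowColumnSystem G H (Fin (ωG + ωH + m))
  system = reindex
    (cliqueSystem A B
      (complement (Clique.vertex A) (Clique.injective A) m (room-left (n G) (n H ∸ ωH) ωG ωG≤∣V∣))
      (complement (Clique.vertex B) (Clique.injective B) m (room-right (n G ∸ ωG) (n H) ωH ωH≤∣V∣)))
    (toBranchIndex ωG ωH m) (toBranchIndex-injective ωG ωH m)
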